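{- Let $p\ge 5$ be a prime such that $X^3-X-1$ has three distinct roots $\alpha,\beta,\gamma$ in $\mathbb{F}_p$. Let $(a_n)_{n\in\mathbb{Z}}$ be a complete Padovan sequence in $\mathbb{F}_p$ with initial values $(a_0,a_1,a_2)=(1,b,c)$, and assume $\gamma^2 b+\gamma c+1=0$, so that $a_n=A\alpha^n+B\beta^n$ for all $n$, where $A=\frac{\alpha^2 b+\alpha c+1}{2\alpha+3}$ and $B=\frac{\beta^2 b+\beta c+1}{2\beta+3}$. Let $N$ be the multiplicative order of $\alpha/\beta$ in $\mathbb{F}_p^*$. Then the multiplicative orders of $\alpha^N$ and of $\beta^N$ in $\mathbb{F}_p^*$ are both equal to $(p-1)/N$.
   Context: A complete Padovan sequence in $\mathbb{F}_p$ is a sequence $(a_n)_{n\in\mathbb{Z}}$ in $\mathbb{F}_p$ with $a_0=1$, $a_{n+3}=a_n+a_{n+1}$ for all $n$, periodic with period $p-1$, and with $\{a_1,\dots,a_{p-2}\}=\{2,\dots,p-1\}$. -}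

module Defs where

open import Data.Nat using (ℕ; zero; suc; _+_; _*_; _∸_; _≤_; _<_; NonZero)
open import Data.Nat.DivMod using (_mod_)
open import Data.Fin using (Fin; toℕ)
open import Data.Integer as ℤ using (ℤ; +_)
open import Data.Product using (Σ; _×_; ∃-syntax)
open import Relation.Binary.PropositionalEquality using (_≡_)

module Fp (p : ℕ) .{{_ : NonZero p}} where

  F : Set
  F = Fin p

  0F 1F : F
  0F = 0 mod p
  1F = 1 mod p

  infixl 6 _+F_ _-F_
  infixl 7 _*F_
  infixr 8 _^F_

  _+F_ : F → F → F
  x +F y = (toℕ x + toℕ y) mod p

  _-F_ : F → F → F
  x -F y = (toℕ x + (p ∸ toℕ y)) mod p

  _*F_ : F → F → F
  x *F y = (toℕ x * toℕ y) mod p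

  _^F_ : F → ℕ → F
  x ^F zero  = 1F
  x ^F suc n = x *F (x ^F n)

  IsRoot : F → Set
  IsRoot x = x ^F 3 -F x -F 1F ≡ 0F

  IsOrder : F → ℕ → Set
  IsOrder x n = 0 < n × x ^F n ≡ 1F × (∀ m → 0 < m → x ^F m ≡ 1F → n ≤ m)

  record IsCompletePadovan (a : ℤ → F) : Set where
    field
      init     : a (+ 0) ≡ 1F
      recur    : ∀ n → a (n ℤ.+ + 3) ≡ a n +F a (n ℤ.+ + 1)
      periodic : ∀ n → a (n ℤ.+ + (p ∸ 1)) ≡ a n
      values⊆  : ∀ i → 1 ≤ i → i ≤ p ∸ 2 → 2 ≤ toℕ (a (+ i))
      values⊇  : ∀ v → 2 ≤ v → v < p →
                 ∃[ i ] (1 ≤ i × i ≤ p ∸ 2 × toℕ (a (+ i)) ≡ v)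

{-# OPTIONS --safe #-}
-- Since γ² b + γ c + 1 = 0, the sequence has no γ-component: it satisfies the two-term
-- recurrence with characteristic roots α and β, whence (α − β) a_K = αᴷ (b − β) − βᴷ (b − α).
-- So αᴷ = βᴷ = 1 forces a_K = a_0 = 1, which in a complete Padovan sequence happens only
-- when p − 1 ∣ K.  As δ = α/β has order N ∣ p − 1 (Fermat), αᴺ = βᴺ; then (αᴺ)ᵐ = 1 gives
-- αᴺᵐ = βᴺᵐ = 1, hence p − 1 ∣ N m, i.e. (p − 1)/N ∣ m, while (αᴺ)^((p−1)/N) = α^(p−1) = 1.
module Submission where

open import Defs
open import Data.Nat using (ℕ; _≤_; _*_; _∸_; NonZero)
open import Data.Nat.Primality using (Prime)
open import Data.Integer using (ℤ; +_)
open import Data.Product using (Σ; _×_; ∃-syntax)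
open import Relation.Binary.PropositionalEquality using (_≡_)
open import Relation.Nullary using (¬_)

open import Data.Nat as ℕ using (zero; suc; _+_; _<_; _!; >-nonZero; nonTrivial⇒n>1)
import Data.Nat.Properties as ℕ
open import Data.Nat.DivMod using (_%_; _/_; _mod_; m%n<n; m%n≤m; m<n⇒m%n≡m; [m+n]%n≡m%n; [m+kn]%n≡m%n;
  %-distribˡ-+; %-distribˡ-*; m≡m%n+[m/n]*n; m*[n/m]≡n; m/n*n≡m)
open import Data.Nat.Divisibility using (_∣_; _∤_; divides; ∣⇒≤; ∣1⇒≡1; m%n≡0⇒n∣m; *-cancelˡ-∣; m∣m*n)
open import Data.Nat.Primality using (euclidsLemma; ¬prime[1]; prime⇒nonTrivial)
open import Data.Nat.Combinatorics using (_C_; nCn≡1; nCk≡n!/k![n-k]!; k![n∸k]!∣n!)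
open import Data.Fin as Fin using (Fin; toℕ; fromℕ; inject₁)
open import Data.Fin.Properties using (toℕ-injective; toℕ-fromℕ<; toℕ<n; toℕ-fromℕ; toℕ-inject₁)
open import Data.Integer as ℤ using (-[1+_]; _⊖_; _◃_; sign; ∣_∣)
import Data.Integer.Properties as ℤ
open import Data.Sign as Sign using (Sign)
open import Data.Maybe using (Maybe; just; nothing)
import Data.Vec.Functional as Vector
open import Data.Product using (_,_)
import Data.Sum as Sum
open import Data.Sum using (_⊎_; [_,_]′)
open import Data.Empty using (⊥-elim)
open import Function using (id; _∘_)
open import Relation.Nullary using (yes; no)
open import Relation.Binary.PropositionalEquality
  using (refl; sym; trans; cong; cong₂; subst; subst₂; isEquivalence; _≢_; module ≡-Reasoning)
open import Algebra.Bundles using (CommutativeRing)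
open import Algebra.Structures using (IsCommutativeRing)
open import Algebra.Consequences.Propositional using (comm∧idˡ⇒id; comm∧invˡ⇒inv; comm∧distrˡ⇒distr)
import Algebra.Solver.Ring.AlmostCommutativeRing as ACR
import Algebra.Properties.Ring
import Algebra.Properties.CommutativeSemigroup
import Algebra.Properties.CommutativeSemiring.Exp
import Algebra.Properties.CommutativeSemiring.Binomial
import Algebra.Properties.Monoid.Sum
import Algebra.Properties.Monoid.Mult

prime∤m! : ∀ {p m} → Prime p → m < p → p ∤ m !
prime∤m! {p} {zero}  p-prime _   p∣1  = ¬prime[1] (subst Prime (∣1⇒≡1 p∣1) p-prime)
prime∤m! {p} {suc m} p-prime m<p p∣m! =
  [ ℕ.<⇒≱ m<p ∘ ∣⇒≤ , prime∤m! p-prime (ℕ.<-trans (ℕ.n<1+n m) m<p) ]′ (euclidsLemma (suc m) (m !) p-prime p∣m!)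

prime∣C : ∀ {p k} → Prime p → 0 < k → k < p → p ∣ p C k
prime∣C {suc q} {k} p-prime 0<k k<p = [ id , ⊥-elim ∘ p∤k!*[p∸k]! ]′
  (euclidsLemma (p C k) (k ! * (p ∸ k) !) p-prime p∣C*k!*[p∸k]!)
  where
  p = suc q
  k≤p = ℕ.<⇒≤ k<p
  p∣C*k!*[p∸k]! : p ∣ (p C k) * (k ! * (p ∸ k) !)
  p∣C*k!*[p∸k]! = subst (p ∣_)
    (sym (trans (cong (_* (k ! * (p ∸ k) !)) (nCk≡n!/k![n-k]! k≤p))
                (m/n*n≡m {{ℕ._!*_!≢0 k (p ∸ k)}} (k![n∸k]!∣n! k≤p))))
    (m∣m*n (q !))
  p∤k!*[p∸k]! : p ∤ k ! * (p ∸ k) !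
  p∤k!*[p∸k]! p∣k!*[p∸k]! = [ prime∤m! p-prime k<p , prime∤m! p-prime (ℕ.∸-monoʳ-< 0<k k≤p) ]′
    (euclidsLemma (k !) ((p ∸ k) !) p-prime p∣k!*[p∸k]!)

module ResidueRing (p : ℕ) .{{_ : NonZero p}} where
  open Fp p

  ⟦_⟧ : ℕ → F
  ⟦ m ⟧ = m mod p

  toℕ-⟦⟧ : ∀ m → toℕ ⟦ m ⟧ ≡ m % p
  toℕ-⟦⟧ m = toℕ-fromℕ< (m%n<n m p)

  ⟦toℕ⟧ : ∀ x → ⟦ toℕ x ⟧ ≡ x
  ⟦toℕ⟧ x = toℕ-injective (trans (toℕ-⟦⟧ (toℕ x)) (m<n⇒m%n≡m (toℕ<n x)))

  ⟦⟧-cong-% : ∀ {m n} → m % p ≡ n % p → ⟦ m ⟧ ≡ ⟦ n ⟧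
  ⟦⟧-cong-% {m} {n} e = toℕ-injective (trans (toℕ-⟦⟧ m) (trans e (sym (toℕ-⟦⟧ n))))

  ⟦⟧-+ : ∀ m n → ⟦ m + n ⟧ ≡ ⟦ m ⟧ +F ⟦ n ⟧
  ⟦⟧-+ m n = ⟦⟧-cong-% (trans (%-distribˡ-+ m n p)
    (sym (cong₂ (λ a b → (a + b) % p) (toℕ-⟦⟧ m) (toℕ-⟦⟧ n))))

  ⟦⟧-* : ∀ m n → ⟦ m * n ⟧ ≡ ⟦ m ⟧ *F ⟦ n ⟧
  ⟦⟧-* m n = ⟦⟧-cong-% (trans (%-distribˡ-* m n p)
    (sym (cong₂ (λ a b → (a * b) % p) (toℕ-⟦⟧ m) (toℕ-⟦⟧ n))))

  ∣⇒⟦⟧≡0 : ∀ {m} → p ∣ m → ⟦ m ⟧ ≡ 0F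
  ∣⇒⟦⟧≡0 (divides k refl) = ⟦⟧-cong-% ([m+kn]%n≡m%n 0 k p)

  ⟦⟧≡0⇒∣ : ∀ {m} → ⟦ m ⟧ ≡ 0F → p ∣ m
  ⟦⟧≡0⇒∣ {m} ⟦m⟧≡0 = m%n≡0⇒n∣m m p (begin
    m % p         ≡⟨ toℕ-⟦⟧ m ⟨
    toℕ ⟦ m ⟧     ≡⟨ cong toℕ ⟦m⟧≡0 ⟩
    toℕ ⟦ 0 ⟧     ≡⟨ toℕ-⟦⟧ 0 ⟩
    0 % p         ≡⟨ m<n⇒m%n≡m (ℕ.>-nonZero⁻¹ p) ⟩
    0             ∎)
    where open ≡-Reasoning

  negF : F → F
  negF x = ⟦ p ∸ toℕ x ⟧

  -F≡+negF : ∀ x y → x -F y ≡ x +F negF y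
  -F≡+negF x y = trans (⟦⟧-+ (toℕ x) (p ∸ toℕ y)) (cong (_+F negF y) (⟦toℕ⟧ x))

  +F-assoc : ∀ x y z → (x +F y) +F z ≡ x +F (y +F z)
  +F-assoc x y z = begin
    ⟦ toℕ x + toℕ y ⟧ +F z            ≡⟨ cong (⟦ toℕ x + toℕ y ⟧ +F_) (⟦toℕ⟧ z) ⟨
    ⟦ toℕ x + toℕ y ⟧ +F ⟦ toℕ z ⟧    ≡⟨ ⟦⟧-+ (toℕ x + toℕ y) (toℕ z) ⟨
    ⟦ toℕ x + toℕ y + toℕ z ⟧         ≡⟨ cong ⟦_⟧ (ℕ.+-assoc (toℕ x) (toℕ y) (toℕ z)) ⟩
    ⟦ toℕ x + (toℕ y + toℕ z) ⟧       ≡⟨ ⟦⟧-+ (toℕ x) (toℕ y + toℕ z) ⟩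
    ⟦ toℕ x ⟧ +F ⟦ toℕ y + toℕ z ⟧    ≡⟨ cong (_+F (y +F z)) (⟦toℕ⟧ x) ⟩
    x +F (y +F z)                     ∎
    where open ≡-Reasoning

  *F-assoc : ∀ x y z → (x *F y) *F z ≡ x *F (y *F z)
  *F-assoc x y z = begin
    ⟦ toℕ x * toℕ y ⟧ *F z            ≡⟨ cong (⟦ toℕ x * toℕ y ⟧ *F_) (⟦toℕ⟧ z) ⟨
    ⟦ toℕ x * toℕ y ⟧ *F ⟦ toℕ z ⟧    ≡⟨ ⟦⟧-* (toℕ x * toℕ y) (toℕ z) ⟨
    ⟦ toℕ x * toℕ y * toℕ z ⟧         ≡⟨ cong ⟦_⟧ (ℕ.*-assoc (toℕ x) (toℕ y) (toℕ z)) ⟩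
    ⟦ toℕ x * (toℕ y * toℕ z) ⟧       ≡⟨ ⟦⟧-* (toℕ x) (toℕ y * toℕ z) ⟩
    ⟦ toℕ x ⟧ *F ⟦ toℕ y * toℕ z ⟧    ≡⟨ cong (_*F (y *F z)) (⟦toℕ⟧ x) ⟩
    x *F (y *F z)                     ∎
    where open ≡-Reasoning

  *F-distribˡ-+F : ∀ x y z → x *F (y +F z) ≡ x *F y +F x *F z
  *F-distribˡ-+F x y z = begin
    x *F ⟦ toℕ y + toℕ z ⟧                ≡⟨ cong (_*F ⟦ toℕ y + toℕ z ⟧) (⟦toℕ⟧ x) ⟨
    ⟦ toℕ x ⟧ *F ⟦ toℕ y + toℕ z ⟧        ≡⟨ ⟦⟧-* (toℕ x) (toℕ y + toℕ z) ⟨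
    ⟦ toℕ x * (toℕ y + toℕ z) ⟧           ≡⟨ cong ⟦_⟧ (ℕ.*-distribˡ-+ (toℕ x) (toℕ y) (toℕ z)) ⟩
    ⟦ toℕ x * toℕ y + toℕ x * toℕ z ⟧     ≡⟨ ⟦⟧-+ (toℕ x * toℕ y) (toℕ x * toℕ z) ⟩
    x *F y +F x *F z                      ∎
    where open ≡-Reasoning

  +F-comm : ∀ x y → x +F y ≡ y +F x
  +F-comm x y = cong ⟦_⟧ (ℕ.+-comm (toℕ x) (toℕ y))

  *F-comm : ∀ x y → x *F y ≡ y *F x
  *F-comm x y = cong ⟦_⟧ (ℕ.*-comm (toℕ x) (toℕ y))

  +F-identityˡ : ∀ x → 0F +F x ≡ x
  +F-identityˡ x = begin
    ⟦ 0 ⟧ +F x          ≡⟨ cong (⟦ 0 ⟧ +F_) (⟦toℕ⟧ x) ⟨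
    ⟦ 0 ⟧ +F ⟦ toℕ x ⟧  ≡⟨ ⟦⟧-+ 0 (toℕ x) ⟨
    ⟦ toℕ x ⟧           ≡⟨ ⟦toℕ⟧ x ⟩
    x                   ∎
    where open ≡-Reasoning

  *F-identityˡ : ∀ x → 1F *F x ≡ x
  *F-identityˡ x = begin
    ⟦ 1 ⟧ *F x          ≡⟨ cong (⟦ 1 ⟧ *F_) (⟦toℕ⟧ x) ⟨
    ⟦ 1 ⟧ *F ⟦ toℕ x ⟧  ≡⟨ ⟦⟧-* 1 (toℕ x) ⟨
    ⟦ 1 * toℕ x ⟧       ≡⟨ cong ⟦_⟧ (ℕ.*-identityˡ (toℕ x)) ⟩
    ⟦ toℕ x ⟧           ≡⟨ ⟦toℕ⟧ x ⟩
    x                   ∎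
    where open ≡-Reasoning

  negF-inverseˡ : ∀ x → (negF x) +F x ≡ 0F
  negF-inverseˡ x = begin
    ⟦ p ∸ toℕ x ⟧ +F x           ≡⟨ cong (⟦ p ∸ toℕ x ⟧ +F_) (⟦toℕ⟧ x) ⟨
    ⟦ p ∸ toℕ x ⟧ +F ⟦ toℕ x ⟧   ≡⟨ ⟦⟧-+ (p ∸ toℕ x) (toℕ x) ⟨
    ⟦ p ∸ toℕ x + toℕ x ⟧        ≡⟨ cong ⟦_⟧ (ℕ.m∸n+n≡m (ℕ.<⇒≤ (toℕ<n x))) ⟩
    ⟦ p ⟧                        ≡⟨ ⟦⟧-cong-% ([m+n]%n≡m%n 0 p) ⟩
    ⟦ 0 ⟧                        ∎
    where open ≡-Reasoning

  isCommutativeRing : IsCommutativeRing _≡_ _+F_ _*F_ negF 0F 1F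
  isCommutativeRing = record
    { isRing = record
      { +-isAbelianGroup = record
        { isGroup = record
          { isMonoid = record
            { isSemigroup = record
              { isMagma = record { isEquivalence = isEquivalence ; ∙-cong = cong₂ _+F_ }
              ; assoc = +F-assoc }
            ; identity = comm∧idˡ⇒id +F-comm +F-identityˡ }
          ; inverse = comm∧invˡ⇒inv +F-comm negF-inverseˡ
          ; ⁻¹-cong = cong negF }
        ; comm = +F-comm }
      ; *-cong = cong₂ _*F_
      ; *-assoc = *F-assoc
      ; *-identity = comm∧idˡ⇒id *F-comm *F-identityˡ
      ; distrib = comm∧distrˡ⇒distr (cong₂ _+F_) *F-comm *F-distribˡ-+F }
    ; *-comm = *F-comm }

  commutativeRing : CommutativeRing _ _
  commutativeRing = record { isCommutativeRing = isCommutativeRing }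


-- The solver works with integer coefficients: with p a variable, arithmetic on constants of F
-- does not compute, so coefficients taken in F itself could not be compared.
module ResidueRingSolver (p : ℕ) .{{_ : NonZero p}} where
  open Fp p
  open ResidueRing p
  open CommutativeRing commutativeRing using (-_; _-_; +-identityˡ; +-identityʳ; -‿inverseˡ; +-commutativeSemigroup)
  open Algebra.Properties.Ring (CommutativeRing.ring commutativeRing)
    using (-0#≈0#; -‿involutive; -‿distribˡ-*; -‿distribʳ-*; -‿+-comm; //-rightDividesʳ)
  open import Algebra.Properties.CommutativeSemigroup +-commutativeSemigroup using (x∙yz≈y∙xz)

  fromℤ : ℤ → F
  fromℤ (+ n)    = ⟦ n ⟧
  fromℤ -[1+ n ] = - ⟦ suc n ⟧

  fromℤ-⊖-+ : ∀ m n → fromℤ (m ⊖ n) +F ⟦ n ⟧ ≡ ⟦ m ⟧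
  fromℤ-⊖-+ zero    zero    = +-identityˡ ⟦ 0 ⟧
  fromℤ-⊖-+ zero    (suc n) = -‿inverseˡ ⟦ suc n ⟧
  fromℤ-⊖-+ (suc m) zero    = +-identityʳ ⟦ suc m ⟧
  fromℤ-⊖-+ (suc m) (suc n) = begin
    fromℤ (suc m ⊖ suc n) +F ⟦ suc n ⟧        ≡⟨ cong₂ _+F_ (cong fromℤ (ℤ.[1+m]⊖[1+n]≡m⊖n m n))
                                                            (⟦⟧-+ 1 n) ⟩
    fromℤ (m ⊖ n) +F (⟦ 1 ⟧ +F ⟦ n ⟧)         ≡⟨ x∙yz≈y∙xz (fromℤ (m ⊖ n)) ⟦ 1 ⟧ ⟦ n ⟧ ⟩
    ⟦ 1 ⟧ +F (fromℤ (m ⊖ n) +F ⟦ n ⟧)         ≡⟨ cong (⟦ 1 ⟧ +F_) (fromℤ-⊖-+ m n) ⟩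
    ⟦ 1 ⟧ +F ⟦ m ⟧                            ≡⟨ ⟦⟧-+ 1 m ⟨
    ⟦ suc m ⟧                                 ∎
    where open ≡-Reasoning

  fromℤ-⊖ : ∀ m n → fromℤ (m ⊖ n) ≡ ⟦ m ⟧ - ⟦ n ⟧
  fromℤ-⊖ m n = trans (sym (//-rightDividesʳ ⟦ n ⟧ (fromℤ (m ⊖ n)))) (cong (_- ⟦ n ⟧) (fromℤ-⊖-+ m n))

  fromℤ-neg : ∀ i → fromℤ (ℤ.- i) ≡ - fromℤ i
  fromℤ-neg (+ zero)  = sym -0#≈0#
  fromℤ-neg (+ suc n) = refl
  fromℤ-neg -[1+ n ]  = sym (-‿involutive ⟦ suc n ⟧)

  fromℤ-+ : ∀ i j → fromℤ (i ℤ.+ j) ≡ fromℤ i +F fromℤ j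
  fromℤ-+ (+ m)    (+ n)    = ⟦⟧-+ m n
  fromℤ-+ (+ m)    -[1+ n ] = fromℤ-⊖ m (suc n)
  fromℤ-+ -[1+ m ] (+ n)    = trans (fromℤ-⊖ n (suc m)) (+F-comm ⟦ n ⟧ (- ⟦ suc m ⟧))
  fromℤ-+ -[1+ m ] -[1+ n ] = begin
    - ⟦ suc (suc (m + n)) ⟧           ≡⟨ cong (λ k → - ⟦ suc k ⟧) (ℕ.+-suc m n) ⟨
    - ⟦ suc m + suc n ⟧               ≡⟨ cong -_ (⟦⟧-+ (suc m) (suc n)) ⟩
    - (⟦ suc m ⟧ +F ⟦ suc n ⟧)        ≡⟨ -‿+-comm ⟦ suc m ⟧ ⟦ suc n ⟧ ⟨
    - ⟦ suc m ⟧ +F - ⟦ suc n ⟧        ∎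
    where open ≡-Reasoning

  signed : Sign → F → F
  signed Sign.+ x = x
  signed Sign.- x = - x

  fromℤ-◃ : ∀ s n → fromℤ (s ◃ n) ≡ signed s ⟦ n ⟧
  fromℤ-◃ Sign.+ zero    = refl
  fromℤ-◃ Sign.- zero    = sym -0#≈0#
  fromℤ-◃ Sign.+ (suc n) = refl
  fromℤ-◃ Sign.- (suc n) = refl

  fromℤ-sign : ∀ i → fromℤ i ≡ signed (sign i) ⟦ ∣ i ∣ ⟧
  fromℤ-sign (+ n)    = refl
  fromℤ-sign -[1+ n ] = refl

  signed-* : ∀ s t x y → signed (s Sign.* t) (x *F y) ≡ signed s x *F signed t y
  signed-* Sign.+ Sign.+ x y = refl
  signed-* Sign.+ Sign.- x y = -‿distribʳ-* x y
  signed-* Sign.- Sign.+ x y = -‿distribˡ-* x y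
  signed-* Sign.- Sign.- x y = trans (sym (-‿involutive (x *F y)))
    (trans (cong -_ (-‿distribʳ-* x y)) (-‿distribˡ-* x (- y)))

  fromℤ-* : ∀ i j → fromℤ (i ℤ.* j) ≡ fromℤ i *F fromℤ j
  fromℤ-* i j = begin
    fromℤ ((s Sign.* t) ◃ (∣ i ∣ * ∣ j ∣))        ≡⟨ fromℤ-◃ (s Sign.* t) (∣ i ∣ * ∣ j ∣) ⟩
    signed (s Sign.* t) ⟦ ∣ i ∣ * ∣ j ∣ ⟧          ≡⟨ cong (signed (s Sign.* t)) (⟦⟧-* ∣ i ∣ ∣ j ∣) ⟩
    signed (s Sign.* t) (⟦ ∣ i ∣ ⟧ *F ⟦ ∣ j ∣ ⟧)   ≡⟨ signed-* s t ⟦ ∣ i ∣ ⟧ ⟦ ∣ j ∣ ⟧ ⟩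
    signed s ⟦ ∣ i ∣ ⟧ *F signed t ⟦ ∣ j ∣ ⟧       ≡⟨ cong₂ _*F_ (fromℤ-sign i) (fromℤ-sign j) ⟨
    fromℤ i *F fromℤ j                            ∎
    where
    open ≡-Reasoning
    s = sign i
    t = sign j

  morphism : ℤ.+-*-rawRing ACR.-Raw-AlmostCommutative⟶ ACR.fromCommutativeRing commutativeRing
  morphism = record
    { ⟦_⟧    = fromℤ
    ; +-homo = fromℤ-+
    ; *-homo = fromℤ-*
    ; -‿homo = fromℤ-neg
    ; 0-homo = refl
    ; 1-homo = refl
    }

  fromℤ-≟ : ∀ i j → Maybe (fromℤ i ≡ fromℤ j)
  fromℤ-≟ i j with i ℤ.≟ j
  ... | yes i≡j = just (cong fromℤ i≡j)
  ... | no  _   = nothing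

  open import Algebra.Solver.Ring ℤ.+-*-rawRing (ACR.fromCommutativeRing commutativeRing) morphism fromℤ-≟ public
    using (solve; _:=_; _:+_; _:*_; _:-_; :-_; _:^_; con)

module Powers (p : ℕ) .{{_ : NonZero p}} where
  open Fp p
  open ResidueRing p
  open CommutativeRing commutativeRing using (*-identityˡ; *-identityʳ; commutativeSemiring)
  open Algebra.Properties.CommutativeSemiring.Exp commutativeSemiring using (_^_; ^-homo-*; ^-assocʳ; ^-distrib-*)

  ^F≡^ : ∀ x n → x ^F n ≡ x ^ n
  ^F≡^ x zero    = refl
  ^F≡^ x (suc n) = cong (x *F_) (^F≡^ x n)

  ^F-homo-*F : ∀ x m n → x ^F (m + n) ≡ x ^F m *F x ^F n
  ^F-homo-*F x m n rewrite ^F≡^ x (m + n) | ^F≡^ x m | ^F≡^ x n = ^-homo-* x m n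

  ^F-assocʳ : ∀ x m n → (x ^F m) ^F n ≡ x ^F (m * n)
  ^F-assocʳ x m n rewrite ^F≡^ (x ^F m) n | ^F≡^ x m | ^F≡^ x (m * n) = ^-assocʳ x m n

  ^F-distrib-*F : ∀ x y n → (x *F y) ^F n ≡ x ^F n *F y ^F n
  ^F-distrib-*F x y n rewrite ^F≡^ (x *F y) n | ^F≡^ x n | ^F≡^ y n = ^-distrib-* x y n

  1^F≡1 : ∀ n → 1F ^F n ≡ 1F
  1^F≡1 zero    = refl
  1^F≡1 (suc n) = trans (cong (1F *F_) (1^F≡1 n)) (*-identityˡ 1F)

  ^F-*≡1 : ∀ x n k → x ^F n ≡ 1F → x ^F (n * k) ≡ 1F
  ^F-*≡1 x n k xⁿ≡1 = trans (sym (^F-assocʳ x n k)) (trans (cong (_^F k) xⁿ≡1) (1^F≡1 k))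

  IsOrder⇒∣ : ∀ {x n m} → IsOrder x n → x ^F m ≡ 1F → n ∣ m
  IsOrder⇒∣ {x} {n} {m} (0<n , xⁿ≡1 , minimal) xᵐ≡1 =
    m%n≡0⇒n∣m m n (ℕ.n≤0⇒n≡0 (ℕ.≮⇒≥ λ r>0 → ℕ.<⇒≱ (m%n<n m n) (minimal (m % n) r>0 xʳ≡1)))
    where
    instance _ = >-nonZero 0<n
    xʳ≡1 : x ^F (m % n) ≡ 1F
    xʳ≡1 = begin
      x ^F (m % n)                           ≡⟨ *-identityʳ _ ⟨
      x ^F (m % n) *F 1F                     ≡⟨ cong (x ^F (m % n) *F_) (^F-*≡1 x n (m / n) xⁿ≡1) ⟨
      x ^F (m % n) *F x ^F (n * (m / n))     ≡⟨ ^F-homo-*F x (m % n) (n * (m / n)) ⟨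
      x ^F (m % n + n * (m / n))             ≡⟨ cong (λ k → x ^F (m % n + k)) (ℕ.*-comm n (m / n)) ⟩
      x ^F (m % n + m / n * n)               ≡⟨ cong (x ^F_) (m≡m%n+[m/n]*n m n) ⟨
      x ^F m                                 ≡⟨ xᵐ≡1 ⟩
      1F                                     ∎
      where open ≡-Reasoning

  IsOrder-from-∣ : ∀ {x n} → 0 < n → x ^F n ≡ 1F → (∀ m → x ^F m ≡ 1F → n ∣ m) → IsOrder x n
  IsOrder-from-∣ 0<n xⁿ≡1 n∣ = 0<n , xⁿ≡1 , λ m 0<m xᵐ≡1 → ∣⇒≤ {{>-nonZero 0<m}} (n∣ m xᵐ≡1)

  IsOrder-^F : ∀ x N M {q} → 0 < q → N * M ≡ q → x ^F q ≡ 1F →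
               (∀ m → (x ^F N) ^F m ≡ 1F → q ∣ N * m) → IsOrder (x ^F N) M
  IsOrder-^F x N M {q} 0<q N*M≡q xᵠ≡1 q∣N*m =
    IsOrder-from-∣ (ℕ.>-nonZero⁻¹ M) xᴺᴹ≡1 λ m xᴺᵐ≡1 →
      *-cancelˡ-∣ N (subst (_∣ N * m) (sym N*M≡q) (q∣N*m m xᴺᵐ≡1))
    where
    instance
      N*M≢0 : NonZero (N * M)
      N*M≢0 = >-nonZero (subst (0 <_) (sym N*M≡q) 0<q)
      N≢0 : NonZero N
      N≢0 = ℕ.m*n≢0⇒m≢0 N
      M≢0 : NonZero M
      M≢0 = ℕ.m*n≢0⇒n≢0 N
    xᴺᴹ≡1 : (x ^F N) ^F M ≡ 1F
    xᴺᴹ≡1 = trans (^F-assocʳ x N M) (trans (cong (x ^F_) N*M≡q) xᵠ≡1)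

  ratio-root-of-unity : ∀ {α β δ} N → δ *F β ≡ α → δ ^F N ≡ 1F → α ^F N ≡ β ^F N
  ratio-root-of-unity {α} {β} {δ} N δβ≡α δᴺ≡1 = begin
    α ^F N               ≡⟨ cong (_^F N) δβ≡α ⟨
    (δ *F β) ^F N        ≡⟨ ^F-distrib-*F δ β N ⟩
    δ ^F N *F β ^F N     ≡⟨ cong (_*F β ^F N) δᴺ≡1 ⟩
    1F *F β ^F N         ≡⟨ *-identityˡ (β ^F N) ⟩
    β ^F N               ∎
    where open ≡-Reasoning

module LinearRecurrences (p : ℕ) .{{_ : NonZero p}} where
  open Fp p
  open ResidueRing p
  open ResidueRingSolver p
  open CommutativeRing commutativeRing using (_-_; *-identityˡ; +-identityʳ; zeroʳ)

  +-vanishing : ∀ {x y} c {z} → x ≡ y +F c *F z → z ≡ 0F → x ≡ y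
  +-vanishing {x} {y} c x≡y+c*0 refl = trans x≡y+c*0 (trans (cong (y +F_) (zeroʳ c)) (+-identityʳ y))

  LinearRecurrence₂ : F → F → (ℕ → F) → Set
  LinearRecurrence₂ s t u = ∀ n → u (2 + n) ≡ s *F u (1 + n) - t *F u n

  HasCharacteristicRoots : F → F → (ℕ → F) → Set
  HasCharacteristicRoots α β = LinearRecurrence₂ (α +F β) (α *F β)

  HasCharacteristicRoots-sym : ∀ α β u → HasCharacteristicRoots α β u → HasCharacteristicRoots β α u
  HasCharacteristicRoots-sym α β u recurrence n =
    trans (recurrence n) (cong₂ (λ s t → s *F u (1 + n) - t *F u n) (+F-comm α β) (*F-comm α β))

  geometric : ∀ α β u → HasCharacteristicRoots α β u →
              ∀ n → u (suc n) - β *F u n ≡ α ^F n *F (u 1 - β *F u 0)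
  geometric α β u recurrence zero    = sym (*-identityˡ _)
  geometric α β u recurrence (suc n) = begin
    u (2 + n) - β *F u (1 + n)                                 ≡⟨ cong (_- β *F u (1 + n)) (recurrence n) ⟩
    (α +F β) *F u (1 + n) - α *F β *F u n - β *F u (1 + n)     ≡⟨ step α β (u n) (u (1 + n)) ⟩
    α *F (u (1 + n) - β *F u n)                                ≡⟨ cong (α *F_) (geometric α β u recurrence n) ⟩
    α *F (α ^F n *F (u 1 - β *F u 0))                          ≡⟨ *F-assoc α (α ^F n) _ ⟨
    α ^F suc n *F (u 1 - β *F u 0)                             ∎
    where
    open ≡-Reasoning
    step : ∀ α β u₀ u₁ → (α +F β) *F u₁ - α *F β *F u₀ - β *F u₁ ≡ α *F (u₁ - β *F u₀)
    step = solve 4 (λ α β u₀ u₁ →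
      (α :+ β) :* u₁ :- α :* β :* u₀ :- β :* u₁ := α :* (u₁ :- β :* u₀)) refl

  binet : ∀ α β u → HasCharacteristicRoots α β u →
          ∀ n → (α - β) *F u n ≡ α ^F n *F (u 1 - β *F u 0) - β ^F n *F (u 1 - α *F u 0)
  binet α β u recurrence n = begin
    (α - β) *F u n                                              ≡⟨ difference α β (u n) (u (1 + n)) ⟩
    (u (1 + n) - β *F u n) - (u (1 + n) - α *F u n)             ≡⟨ cong₂ _-_ (geometric α β u recurrence n)
                                                                             (geometric β α u recurrence′ n) ⟩
    α ^F n *F (u 1 - β *F u 0) - β ^F n *F (u 1 - α *F u 0)     ∎
    where
    open ≡-Reasoning
    recurrence′ = HasCharacteristicRoots-sym α β u recurrence
    difference : ∀ α β uₙ uₙ₊₁ → (α - β) *F uₙ ≡ (uₙ₊₁ - β *F uₙ) - (uₙ₊₁ - α *F uₙ)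
    difference = solve 4 (λ α β uₙ uₙ₊₁ →
      (α :- β) :* uₙ := (uₙ₊₁ :- β :* uₙ) :- (uₙ₊₁ :- α :* uₙ)) refl

  binet-return : ∀ α β u K → HasCharacteristicRoots α β u → α ^F K ≡ 1F → β ^F K ≡ 1F →
                 (α - β) *F u K ≡ (α - β) *F u 0
  binet-return α β u K recurrence αᴷ≡1 βᴷ≡1 =
    trans (binet α β u recurrence K)
          (trans (cong₂ (λ a b → a *F (u 1 - β *F u 0) - b *F (u 1 - α *F u 0)) αᴷ≡1 βᴷ≡1)
                 (sym (binet α β u recurrence 0)))

module Padovan (p : ℕ) .{{_ : NonZero p}} where
  open Fp p
  open ResidueRing p
  open ResidueRingSolver p
  open LinearRecurrences p using (+-vanishing; LinearRecurrence₂)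
  open CommutativeRing commutativeRing using (-_; _-_; zeroʳ)

  charPoly : F → F
  charPoly x = x ^F 3 - x - 1F

  IsRoot⇒charPoly≡0 : ∀ x → IsRoot x → charPoly x ≡ 0F
  IsRoot⇒charPoly≡0 x root = trans (sym (trans (-F≡+negF (x ^F 3 -F x) 1F) (cong (_- 1F) (-F≡+negF (x ^F 3) x)))) root

  IsPadovan : (ℕ → F) → Set
  IsPadovan u = ∀ n → u (3 + n) ≡ u n +F u (1 + n)

  -- u acted on by the shift-operator polynomial X² + γX + (γ² − 1) = (X³ − X − 1)/(X − γ).
  residual : F → (ℕ → F) → ℕ → F
  residual γ u n = u (2 + n) +F γ *F u (1 + n) +F (γ ^F 2 - 1F) *F u n

  residual-step : ∀ γ u → charPoly γ ≡ 0F → IsPadovan u → ∀ n → residual γ u (suc n) ≡ γ *F residual γ u n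
  residual-step γ u γ-root padovan n = +-vanishing (- u n) (begin
    u (3 + n) +F γ *F u (2 + n) +F c *F u (1 + n)              ≡⟨ cong (λ v → v +F γ *F u (2 + n) +F c *F u (1 + n))
                                                                        (padovan n) ⟩
    u n +F u (1 + n) +F γ *F u (2 + n) +F c *F u (1 + n)       ≡⟨ factor γ (u n) (u (1 + n)) (u (2 + n)) ⟩
    γ *F residual γ u n +F (- u n) *F charPoly γ               ∎) γ-root
    where
    open ≡-Reasoning
    c = γ ^F 2 - 1F
    factor : ∀ γ u₀ u₁ u₂ → u₀ +F u₁ +F γ *F u₂ +F (γ ^F 2 - 1F) *F u₁ ≡
                            γ *F (u₂ +F γ *F u₁ +F (γ ^F 2 - 1F) *F u₀) +F (- u₀) *F charPoly γ
    factor = solve 4 (λ γ u₀ u₁ u₂ → u₀ :+ u₁ :+ γ :* u₂ :+ (γ :^ 2 :- con (+ 1)) :* u₁ :=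
      γ :* (u₂ :+ γ :* u₁ :+ (γ :^ 2 :- con (+ 1)) :* u₀) :+ (:- u₀) :* (γ :^ 3 :- γ :- con (+ 1))) refl

  γ*residual-0 : ∀ γ u → charPoly γ ≡ 0F → γ *F residual γ u 0 ≡ γ ^F 2 *F u 1 +F γ *F u 2 +F u 0
  γ*residual-0 γ u γ-root = +-vanishing (u 0) (expand γ (u 0) (u 1) (u 2)) γ-root
    where
    expand : ∀ γ u₀ u₁ u₂ → γ *F (u₂ +F γ *F u₁ +F (γ ^F 2 - 1F) *F u₀) ≡
                            γ ^F 2 *F u₁ +F γ *F u₂ +F u₀ +F u₀ *F charPoly γ
    expand = solve 4 (λ γ u₀ u₁ u₂ → γ :* (u₂ :+ γ :* u₁ :+ (γ :^ 2 :- con (+ 1)) :* u₀) :=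
      γ :^ 2 :* u₁ :+ γ :* u₂ :+ u₀ :+ u₀ :* (γ :^ 3 :- γ :- con (+ 1))) refl

  padovan-reduction : ∀ γ u → charPoly γ ≡ 0F → IsPadovan u → residual γ u 0 ≡ 0F →
                      LinearRecurrence₂ (- γ) (γ ^F 2 - 1F) u
  padovan-reduction γ u γ-root padovan residual₀≡0 n =
    +-vanishing 1F (solve-for-u₂ γ (u n) (u (1 + n)) (u (2 + n))) (residual≡0 n)
    where
    residual≡0 : ∀ n → residual γ u n ≡ 0F
    residual≡0 zero    = residual₀≡0
    residual≡0 (suc n) = trans (residual-step γ u γ-root padovan n) (trans (cong (γ *F_) (residual≡0 n)) (zeroʳ γ))
    solve-for-u₂ : ∀ γ u₀ u₁ u₂ →
                   u₂ ≡ (- γ) *F u₁ - (γ ^F 2 - 1F) *F u₀ +F 1F *F (u₂ +F γ *F u₁ +F (γ ^F 2 - 1F) *F u₀)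
    solve-for-u₂ = solve 4 (λ γ u₀ u₁ u₂ → u₂ :=
      (:- γ) :* u₁ :- (γ :^ 2 :- con (+ 1)) :* u₀
        :+ con (+ 1) :* (u₂ :+ γ :* u₁ :+ (γ :^ 2 :- con (+ 1)) :* u₀)) refl

  module _ {a : ℤ → F} (complete : IsCompletePadovan a) where
    open IsCompletePadovan complete

    IsCompletePadovan⇒IsPadovan : IsPadovan (λ n → a (+ n))
    IsCompletePadovan⇒IsPadovan n = trans (cong (λ m → a (+ m)) (ℕ.+-comm 3 n))
      (trans (recur (+ n)) (cong (λ m → a (+ n) +F a (+ m)) (ℕ.+-comm n 1)))

    periodic-multiple : ∀ r k → a (+ (r + k * (p ∸ 1))) ≡ a (+ r)
    periodic-multiple r zero    = cong (λ m → a (+ m)) (ℕ.+-identityʳ r)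
    periodic-multiple r (suc k) = trans (cong (λ m → a (+ m)) shuffle)
      (trans (periodic (+ (r + k * (p ∸ 1)))) (periodic-multiple r k))
      where
      shuffle : r + ((p ∸ 1) + k * (p ∸ 1)) ≡ r + k * (p ∸ 1) + (p ∸ 1)
      shuffle = trans (cong (λ m → r + m) (ℕ.+-comm (p ∸ 1) (k * (p ∸ 1))))
                      (sym (ℕ.+-assoc r (k * (p ∸ 1)) (p ∸ 1)))

    a≡1⇒p∸1∣ : .{{_ : NonZero (p ∸ 1)}} → ∀ K → a (+ K) ≡ 1F → (p ∸ 1) ∣ K
    a≡1⇒p∸1∣ K aᴷ≡1 = m%n≡0⇒n∣m K (p ∸ 1) (ℕ.n≤0⇒n≡0 (ℕ.≮⇒≥ λ r>0 →
      ℕ.<⇒≱ (values⊆ r r>0 r≤p∸2) (subst (λ v → toℕ v ≤ 1) (sym aʳ≡1) toℕ-1F≤1)))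
      where
      r = K % (p ∸ 1)
      r≤p∸2 : r ≤ p ∸ 2
      r≤p∸2 = subst (r ≤_) (ℕ.pred[m∸n]≡m∸[1+n] p 1) (ℕ.<⇒≤pred (m%n<n K (p ∸ 1)))
      aʳ≡1 : a (+ r) ≡ 1F
      aʳ≡1 = trans (sym (periodic-multiple r (K / (p ∸ 1))))
                   (trans (cong (λ m → a (+ m)) (sym (m≡m%n+[m/n]*n K (p ∸ 1)))) aᴷ≡1)
      toℕ-1F≤1 : toℕ 1F ≤ 1
      toℕ-1F≤1 = subst (_≤ 1) (sym (toℕ-⟦⟧ 1)) (m%n≤m 1 p)

module PrimeField (q : ℕ) (p-prime : Prime (suc q)) where
  p : ℕ
  p = suc q

  open Fp p
  open ResidueRing p
  open ResidueRingSolver p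
  open Powers p
  open LinearRecurrences p
  open Padovan p
  open CommutativeRing commutativeRing
    using ( -_; _-_; -‿inverseʳ; zeroˡ; zeroʳ; distribʳ; +-identityʳ; *-identityˡ; *-identityʳ
          ; +-monoid; ring; commutativeSemiring)
  open Algebra.Properties.Ring ring
    using (-0#≈0#; x[y-z]≈xy-xz; x∙y⁻¹≈ε⇒x≈y; x≈y⇒x∙y⁻¹≈ε; +-inverseˡ-unique)
  open Algebra.Properties.CommutativeSemiring.Exp commutativeSemiring using (_^_)
  open Algebra.Properties.CommutativeSemiring.Binomial commutativeSemiring using (theorem; binomialTerm; binomialExpansion)
  open Algebra.Properties.Monoid.Sum +-monoid using (sum; sum-init-last; sum-cong-≗; sum-replicate-zero)
  open Algebra.Properties.Monoid.Mult +-monoid using () renaming (_×_ to _·_)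

  1F≢0F : 1F ≢ 0F
  1F≢0F 1≡0 = ¬prime[1] (subst Prime (∣1⇒≡1 (⟦⟧≡0⇒∣ 1≡0)) p-prime)

  *F-integral : ∀ {x y} → x *F y ≡ 0F → x ≡ 0F ⊎ y ≡ 0F
  *F-integral {x} {y} xy≡0 =
    Sum.map ∣toℕ⇒≡0 ∣toℕ⇒≡0 (euclidsLemma (toℕ x) (toℕ y) p-prime (⟦⟧≡0⇒∣ xy≡0))
    where
    ∣toℕ⇒≡0 : ∀ {z} → p ∣ toℕ z → z ≡ 0F
    ∣toℕ⇒≡0 {z} p∣z = trans (sym (⟦toℕ⟧ z)) (∣⇒⟦⟧≡0 p∣z)

  ≢⇒-≢0 : ∀ {x y} → x ≢ y → x - y ≢ 0F
  ≢⇒-≢0 {x} {y} x≢y x-y≡0 = x≢y (x∙y⁻¹≈ε⇒x≈y x y x-y≡0)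

  *F-cancelˡ : ∀ {x y z} → x ≢ 0F → x *F y ≡ x *F z → y ≡ z
  *F-cancelˡ {x} {y} {z} x≢0 xy≡xz = [ ⊥-elim ∘ x≢0 , x∙y⁻¹≈ε⇒x≈y y z ]′
    (*F-integral (trans (x[y-z]≈xy-xz x y z) (x≈y⇒x∙y⁻¹≈ε xy≡xz)))

  *F≡0⇒≡0ʳ : ∀ {x y} → x ≢ 0F → x *F y ≡ 0F → y ≡ 0F
  *F≡0⇒≡0ʳ {x} x≢0 xy≡0 = *F-cancelˡ x≢0 (trans xy≡0 (sym (zeroʳ x)))

  *F≢0⇒≢0ˡ : ∀ {x y} → x *F y ≢ 0F → x ≢ 0F
  *F≢0⇒≢0ˡ {x} {y} xy≢0 x≡0 = xy≢0 (trans (cong (_*F y) x≡0) (zeroˡ y))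

  ·≡⟦⟧*F : ∀ n x → n · x ≡ ⟦ n ⟧ *F x
  ·≡⟦⟧*F zero    x = sym (zeroˡ x)
  ·≡⟦⟧*F (suc n) x = begin
    x +F n · x                ≡⟨ cong₂ _+F_ (*-identityˡ x) (sym (·≡⟦⟧*F n x)) ⟨
    1F *F x +F ⟦ n ⟧ *F x     ≡⟨ distribʳ x 1F ⟦ n ⟧ ⟨
    (1F +F ⟦ n ⟧) *F x        ≡⟨ cong (_*F x) (⟦⟧-+ 1 n) ⟨
    ⟦ suc n ⟧ *F x            ∎
    where open ≡-Reasoning

  sum-first-last : ∀ {n} (t : Fin (suc (suc n)) → F) → (∀ i → t (Fin.suc (inject₁ i)) ≡ 0F) →
                   sum t ≡ t Fin.zero +F t (fromℕ (suc n))
  sum-first-last {n} t interior≡0 = cong (t Fin.zero +F_) (begin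
    sum (Vector.tail t)                          ≡⟨ sum-init-last (Vector.tail t) ⟩
    sum (Vector.init (Vector.tail t)) +F tₗ      ≡⟨ cong (_+F tₗ) (trans (sum-cong-≗ interior≡0) (sum-replicate-zero n)) ⟩
    0F +F tₗ                                     ≡⟨ +F-identityˡ tₗ ⟩
    tₗ                                           ∎)
    where
    open ≡-Reasoning
    tₗ = t (fromℕ (suc n))

  frobenius : ∀ x y → (x +F y) ^ p ≡ x ^ p +F y ^ p
  frobenius x y = begin
    (x +F y) ^ p                                                  ≡⟨ theorem p x y ⟩
    binomialExpansion x y p                                       ≡⟨ sum-first-last (binomialTerm x y p) interior≡0 ⟩
    binomialTerm x y p Fin.zero +F binomialTerm x y p (fromℕ p)   ≡⟨ cong₂ _+F_ first last′ ⟩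
    y ^ p +F x ^ p                                                ≡⟨ +F-comm (y ^ p) (x ^ p) ⟩
    x ^ p +F y ^ p                                                ∎
    where
    open ≡-Reasoning
    interior≡0 : ∀ i → binomialTerm x y p (Fin.suc (inject₁ i)) ≡ 0F
    interior≡0 i = begin
      (p C k) · b                ≡⟨ ·≡⟦⟧*F (p C k) b ⟩
      ⟦ p C k ⟧ *F b             ≡⟨ cong (_*F b) (∣⇒⟦⟧≡0 (prime∣C p-prime (ℕ.s≤s ℕ.z≤n) k<p)) ⟩
      0F *F b                    ≡⟨ zeroˡ b ⟩
      0F                         ∎
      where
      k = toℕ (Fin.suc (inject₁ i))
      b = x ^ k *F y ^ (p ∸ k)
      k<p : k < p
      k<p = ℕ.s≤s (subst (_< q) (sym (toℕ-inject₁ i)) (toℕ<n i))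
    first : binomialTerm x y p Fin.zero ≡ y ^ p
    first = trans (+-identityʳ _) (*-identityˡ _)
    last′ : binomialTerm x y p (fromℕ p) ≡ x ^ p
    last′ = begin
      binomialTerm x y p (fromℕ p)        ≡⟨ cong (λ j → (p C j) · (x ^ j *F y ^ (p ∸ j))) (toℕ-fromℕ p) ⟩
      (p C p) · (x ^ p *F y ^ (p ∸ p))    ≡⟨ cong₂ (λ c e → c · (x ^ p *F y ^ e)) (nCn≡1 p) (ℕ.n∸n≡0 p) ⟩
      1 · (x ^ p *F 1F)                   ≡⟨ trans (+-identityʳ _) (*-identityʳ _) ⟩
      x ^ p                               ∎

  ^p≡id : ∀ x → x ^ p ≡ x
  ^p≡id x = trans (cong (_^ p) (sym (⟦toℕ⟧ x))) (trans (⟦n⟧^p≡⟦n⟧ (toℕ x)) (⟦toℕ⟧ x))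
    where
    ⟦n⟧^p≡⟦n⟧ : ∀ n → ⟦ n ⟧ ^ p ≡ ⟦ n ⟧
    ⟦n⟧^p≡⟦n⟧ zero    = zeroˡ (⟦ 0 ⟧ ^ q)
    ⟦n⟧^p≡⟦n⟧ (suc n) = begin
      ⟦ suc n ⟧ ^ p          ≡⟨ cong (_^ p) (⟦⟧-+ 1 n) ⟩
      (1F +F ⟦ n ⟧) ^ p      ≡⟨ frobenius 1F ⟦ n ⟧ ⟩
      1F ^ p +F ⟦ n ⟧ ^ p    ≡⟨ cong₂ _+F_ (trans (sym (^F≡^ 1F p)) (1^F≡1 p)) (⟦n⟧^p≡⟦n⟧ n) ⟩
      1F +F ⟦ n ⟧            ≡⟨ ⟦⟧-+ 1 n ⟨
      ⟦ suc n ⟧              ∎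
      where open ≡-Reasoning

  fermat : ∀ {x} → x ≢ 0F → x ^F q ≡ 1F
  fermat {x} x≢0 = *F-cancelˡ x≢0 (trans (^F≡^ x p) (trans (^p≡id x) (sym (*-identityʳ x))))

  instance
    q≢0 : NonZero q
    q≢0 = >-nonZero (ℕ.s≤s⁻¹ (nonTrivial⇒n>1 p {{prime⇒nonTrivial p-prime}}))

  charPoly-root≢0 : ∀ x → charPoly x ≡ 0F → x ≢ 0F
  charPoly-root≢0 x root x≡0 = 1F≢0F (begin
    1F                       ≡⟨ solve 0 (con (+ 1) := :- (con (+ 0) :^ 3 :- con (+ 0) :- con (+ 1))) refl ⟩
    - charPoly 0F            ≡⟨ cong (λ z → - charPoly z) x≡0 ⟨
    - charPoly x             ≡⟨ cong -_ root ⟩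
    - 0F                     ≡⟨ -0#≈0# ⟩
    0F                       ∎)
    where open ≡-Reasoning

  dividedDifference : F → F → F
  dividedDifference x y = x ^F 2 +F x *F y +F y ^F 2 - 1F

  dividedDifference≡0 : ∀ {x y} → charPoly x ≡ 0F → charPoly y ≡ 0F → x ≢ y → dividedDifference x y ≡ 0F
  dividedDifference≡0 {x} {y} x-root y-root x≢y = *F≡0⇒≡0ʳ (≢⇒-≢0 x≢y) (begin
    (x - y) *F dividedDifference x y   ≡⟨ factor x y ⟩
    charPoly x - charPoly y            ≡⟨ cong₂ _-_ x-root y-root ⟩
    0F - 0F                            ≡⟨ -‿inverseʳ 0F ⟩
    0F                                 ∎)
    where
    open ≡-Reasoning
    factor : ∀ x y → (x - y) *F dividedDifference x y ≡ charPoly x - charPoly y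
    factor = solve 2 (λ x y → (x :- y) :* (x :^ 2 :+ x :* y :+ y :^ 2 :- con (+ 1)) :=
      (x :^ 3 :- x :- con (+ 1)) :- (y :^ 3 :- y :- con (+ 1))) refl

  module Roots (α β γ : F) (α-root : charPoly α ≡ 0F) (β-root : charPoly β ≡ 0F) (γ-root : charPoly γ ≡ 0F)
               (α≢β : α ≢ β) (α≢γ : α ≢ γ) (β≢γ : β ≢ γ) where

    roots-sum≡0 : α +F β +F γ ≡ 0F
    roots-sum≡0 = *F≡0⇒≡0ʳ (≢⇒-≢0 β≢γ) (begin
      (β - γ) *F (α +F β +F γ)                         ≡⟨ factor α β γ ⟩
      dividedDifference α β - dividedDifference α γ    ≡⟨ cong₂ _-_ (dividedDifference≡0 α-root β-root α≢β)
                                                                    (dividedDifference≡0 α-root γ-root α≢γ) ⟩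
      0F - 0F                                          ≡⟨ -‿inverseʳ 0F ⟩
      0F                                               ∎)
      where
      open ≡-Reasoning
      factor : ∀ α β γ → (β - γ) *F (α +F β +F γ) ≡ dividedDifference α β - dividedDifference α γ
      factor = solve 3 (λ α β γ → (β :- γ) :* (α :+ β :+ γ) :=
        (α :^ 2 :+ α :* β :+ β :^ 2 :- con (+ 1)) :- (α :^ 2 :+ α :* γ :+ γ :^ 2 :- con (+ 1))) refl

    vieta-sum : α +F β ≡ - γ
    vieta-sum = +-inverseˡ-unique (α +F β) γ roots-sum≡0

    vieta-product : α *F β ≡ γ ^F 2 - 1F
    vieta-product = x∙y⁻¹≈ε⇒x≈y _ _ (begin
      α *F β - (γ ^F 2 - 1F)                                 ≡⟨ factor α β γ ⟩
      (α +F β +F γ) *F (α +F β - γ) - dividedDifference α β  ≡⟨ cong₂ (λ s d → s *F (α +F β - γ) - d)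
                                                                        roots-sum≡0
                                                                        (dividedDifference≡0 α-root β-root α≢β) ⟩
      0F *F (α +F β - γ) - 0F                                ≡⟨ cong (_- 0F) (zeroˡ (α +F β - γ)) ⟩
      0F - 0F                                                ≡⟨ -‿inverseʳ 0F ⟩
      0F                                                     ∎)
      where
      open ≡-Reasoning
      factor : ∀ α β γ → α *F β - (γ ^F 2 - 1F) ≡ (α +F β +F γ) *F (α +F β - γ) - dividedDifference α β
      factor = solve 3 (λ α β γ → α :* β :- (γ :^ 2 :- con (+ 1)) :=
        (α :+ β :+ γ) :* (α :+ β :- γ) :- (α :^ 2 :+ α :* β :+ β :^ 2 :- con (+ 1))) refl

    α≢0 : α ≢ 0F
    α≢0 = charPoly-root≢0 α α-root

    module _ {a : ℤ → F} (complete : IsCompletePadovan a)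
             (γ-component : γ ^F 2 *F a (+ 1) +F γ *F a (+ 2) +F 1F ≡ 0F) where
      open IsCompletePadovan complete using (init)

      has-roots-α-β : HasCharacteristicRoots α β (λ n → a (+ n))
      has-roots-α-β = subst₂ (λ s t → LinearRecurrence₂ s t u) (sym vieta-sum) (sym vieta-product)
        (padovan-reduction γ u γ-root (IsCompletePadovan⇒IsPadovan complete) residual₀≡0)
        where
        u : ℕ → F
        u n = a (+ n)
        residual₀≡0 : residual γ u 0 ≡ 0F
        residual₀≡0 = *F≡0⇒≡0ʳ (charPoly-root≢0 γ γ-root)
          (trans (γ*residual-0 γ u γ-root) (trans (cong (γ ^F 2 *F u 1 +F γ *F u 2 +F_) init) γ-component))

      roots-of-unity⇒q∣ : ∀ K → α ^F K ≡ 1F → β ^F K ≡ 1F → q ∣ K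
      roots-of-unity⇒q∣ K αᴷ≡1 βᴷ≡1 =
        a≡1⇒p∸1∣ complete K (trans (*F-cancelˡ (≢⇒-≢0 α≢β) [α-β]aₖ≡[α-β]a₀) init)
        where
        [α-β]aₖ≡[α-β]a₀ = binet-return α β (λ n → a (+ n)) K has-roots-α-β αᴷ≡1 βᴷ≡1

lemma4p1 : (p : ℕ) .{{_ : NonZero p}} → Prime p → 5 ≤ p →
    let open Fp p in
    (α β γ : F) → IsRoot α → IsRoot β → IsRoot γ →
    ¬ (α ≡ β) → ¬ (α ≡ γ) → ¬ (β ≡ γ) →
    (a : ℤ → F) → IsCompletePadovan a →
    (b c : F) → a (+ 1) ≡ b → a (+ 2) ≡ c →
    γ ^F 2 *F b +F γ *F c +F 1F ≡ 0F →
    (δ : F) → δ *F β ≡ α →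
    (N : ℕ) → IsOrder δ N →
    ∃[ M ] (N * M ≡ p ∸ 1 × IsOrder (α ^F N) M × IsOrder (β ^F N) M)
lemma4p1 (suc q) p-prime _ α β γ α-root β-root γ-root α≢β α≢γ β≢γ a complete _ _ refl refl γ-component
         δ δβ≡α N δ-order@(0<N , δᴺ≡1 , _) =
  M , N*M≡q , αᴺ-order , subst (λ y → IsOrder y M) αᴺ≡βᴺ αᴺ-order
  where
  open Fp (suc q)
  open Powers (suc q)
  open Padovan (suc q) using (IsRoot⇒charPoly≡0)
  open PrimeField q p-prime
  open Roots α β γ (IsRoot⇒charPoly≡0 α α-root) (IsRoot⇒charPoly≡0 β β-root) (IsRoot⇒charPoly≡0 γ γ-root)
             α≢β α≢γ β≢γ
  instance _ = >-nonZero 0<N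

  M : ℕ
  M = q / N

  N*M≡q : N * M ≡ q
  N*M≡q = m*[n/m]≡n (IsOrder⇒∣ δ-order (fermat (*F≢0⇒≢0ˡ (subst (_≢ 0F) (sym δβ≡α) α≢0))))

  αᴺ≡βᴺ : α ^F N ≡ β ^F N
  αᴺ≡βᴺ = ratio-root-of-unity N δβ≡α δᴺ≡1

  αᴺ-order : IsOrder (α ^F N) M
  αᴺ-order = IsOrder-^F α N M (ℕ.>-nonZero⁻¹ q) N*M≡q (fermat α≢0) λ m αᴺᵐ≡1 →
    roots-of-unity⇒q∣ complete γ-component (N * m)
      (trans (sym (^F-assocʳ α N m)) αᴺᵐ≡1)
      (trans (sym (^F-assocʳ β N m)) (subst (λ y → y ^F m ≡ 1F) αᴺ≡βᴺ αᴺᵐ≡1))
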